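{- For all integers $n, m, k$ with $n \geq m \geq k+1 \geq 4$, we have $\sigma(K_m - P_k, n) \geq (2m-6)n - (m-3)(m-2) + 2$.
   Context: A sequence $S=(d_1,\dots,d_n)$ of non-negative integers is graphical if it is the degree sequence of some simple graph on $n$ vertices (a realization of $S$). A graphical sequence is potentially $H$-graphical if some realization of it contains $H$ as a subgraph. $\sigma(S)=d_1+\dots+d_n$. $P_k$ denotes a path on $k+1$ vertices (with $k$ edges), and $K_m - P_k$ is the graph obtained from the complete graph $K_m$ by removing the $k$ edges of a path $P_k$. $\sigma(H,n)$ is the smallest even integer $l$ such that every $n$-term graphical sequence $S$ with $\sigma(S)\geq l$ is potentially $H$-graphical. -}

module Defs where

open import Data.Nat using (ℕ; zero; suc; _+_; _*_; _∸_; _≤_; _≡ᵇ_; _≤ᵇ_)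
open import Data.Nat.Divisibility using (_∣_)
open import Data.Bool using (Bool; true; false; if_then_else_; _∧_; _∨_; not)
open import Data.Fin using (Fin; toℕ)
open import Data.List using (List; map; allFin)
open import Data.Nat.ListAction using (sum)
open import Data.Product using (Σ; _×_; ∃)
open import Function.Definitions using (Injective)
open import Relation.Binary.PropositionalEquality using (_≡_)

record Graph (n : ℕ) : Set where
  field
    adj    : Fin n → Fin n → Bool
    sym    : ∀ u v → adj u v ≡ adj v u
    irrefl : ∀ u → adj u u ≡ false
open Graph public

degree : ∀ {n} → Graph n → Fin n → ℕ
degree {n} G i = sum (map (λ j → if adj G i j then 1 else 0) (allFin n))

Seq : ℕ → Set
Seq n = Fin n → ℕ

σ : ∀ {n} → Seq n → ℕ
σ {n} S = sum (map S (allFin n))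

Realizes : ∀ {n} → Graph n → Seq n → Set
Realizes {n} G S = ∀ i → degree G i ≡ S i

Graphical : ∀ {n} → Seq n → Set
Graphical {n} S = Σ (Graph n) λ G → Realizes G S

ContainsSubgraph : ∀ {n m} → Graph n → (Fin m → Fin m → Bool) → Set
ContainsSubgraph {n} {m} G H =
  Σ (Fin m → Fin n) λ f → Injective _≡_ _≡_ f ×
    (∀ u v → H u v ≡ true → adj G (f u) (f v) ≡ true)

PotentiallyGraphical : ∀ {n m} → (Fin m → Fin m → Bool) → Seq n → Set
PotentiallyGraphical {n} H S =
  Σ (Graph n) λ G → Realizes G S × ContainsSubgraph G H

-- K_m - P_k on vertices 0..m-1: the removed path is 0 - 1 - ... - k
-- (edges {i, i+1} for i < k).
pathEdge : ∀ {m} → ℕ → Fin m → Fin m → Bool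
pathEdge k u v =
  ((suc (toℕ u) ≡ᵇ toℕ v) ∧ (toℕ v ≤ᵇ k)) ∨ ((suc (toℕ v) ≡ᵇ toℕ u) ∧ (toℕ u ≤ᵇ k))

KmMinusPk : (m k : ℕ) → Fin m → Fin m → Bool
KmMinusPk m k u v = not (toℕ u ≡ᵇ toℕ v) ∧ not (pathEdge k u v)

SigmaProperty : ∀ {m} → (Fin m → Fin m → Bool) → ℕ → ℕ → Set
SigmaProperty H n l = (S : Seq n) → Graphical S → l ≤ σ S → PotentiallyGraphical H S

-- σ(H,n) ≥ B  :⇔  every even l with the property satisfies B ≤ l
-- (σ(H,n) is the least such even l).
SigmaLowerBound : ∀ {m} → (Fin m → Fin m → Bool) → ℕ → ℕ → Set
SigmaLowerBound H n B = ∀ l → 2 ∣ l → SigmaProperty H n l → B ≤ l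

module Submission where

-- The witness is π = ((n − 1)^b, b^(n − b)) with b = m − 3. Its only realization is the
-- split graph K_b ∨ (n − b)K₁: a vertex of degree n − 1 is adjacent to everything, after which
-- a vertex of degree b has no room for further neighbours. The vertices of even index and those
-- of odd index are cliques in K_m − P_k (the removed path only joins consecutive vertices), so
-- at most two vertices of K_m − P_k fit into the independent part and m − 2 > b remain for the
-- b hubs. Hence π is not potentially K_m − P_k-graphical; as σ(π) = (2m − 6)n − (m − 3)(m − 2)
-- is even, every even l with the defining property of σ(K_m − P_k, n) is at least σ(π) + 2.

open import Defs hiding (sym)
open import Data.Bool using (Bool; true; false; if_then_else_; not; _∧_; _∨_)
open import Data.Bool.Properties using (∨-comm; ∧-zeroʳ)
open import Data.Empty using (⊥)
open import Data.Fin as F using (Fin; zero; suc; toℕ; _≟_; fromℕ<; join; splitAt)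
open import Data.Fin.Properties using (pigeonhole; <⇒≢; toℕ-injective; fromℕ<-injective; splitAt-join)
open import Data.List using (map; allFin; tabulate)
open import Data.List.Properties using (map-tabulate; tabulate-cong)
open import Data.Nat using (ℕ; zero; suc; _+_; _*_; _∸_; _≤_; _<_; z≤n; s≤s; _<?_; _≡ᵇ_)
open import Data.Nat.Divisibility using (_∣_; divides; ∣-trans; ∣m∣n⇒∣m+n; ∣m+n∣m⇒∣n; n∣m*n; m∣m*n)
open import Data.Nat.ListAction using (sum)
open import Data.Nat.Properties
  using ( m≤n⇒m≤1+n; <⇒≱; ≤⇒≯; ≮⇒≥; ≰⇒>; ≤-reflexive; ≤-trans; m≤n+m; m≤m+n; n≤1+n; n<1+n
        ; m≤n⇒∃[o]m+o≡n; +-assoc; +-comm; +-identityʳ; *-identityʳ; *-zeroʳ; *-monoˡ-≤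
        ; *-cancelʳ-<; m+n∸m≡n; m+n∸n≡m; module ≤-Reasoning )
  renaming (_≟_ to _≟ℕ_)
open import Data.Nat.Tactic.RingSolver using (solve-∀)
open import Data.Product using (Σ; ∃₂; _×_; _,_)
open import Data.Sum using (_⊎_; inj₁; inj₂)
open import Data.Sum.Properties using (inj₁-injective; inj₂-injective)
open import Function using (_∘_; case_of_)
open import Relation.Nullary using (¬_; Dec; yes; no; does; contradiction)
open import Relation.Nullary.Decidable using (dec-true; dec-false)
open import Relation.Binary.PropositionalEquality

count : ∀ {n} → (Fin n → Bool) → ℕ
count p = sum (tabulate λ j → if p j then 1 else 0)

_⊆ᵇ_ : ∀ {n} → (Fin n → Bool) → (Fin n → Bool) → Set
p ⊆ᵇ q = ∀ j → p j ≡ true → q j ≡ true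

count-mono : ∀ {n} {p q : Fin n → Bool} → p ⊆ᵇ q → count p ≤ count q
count-mono {zero} p⊆q = z≤n
count-mono {suc n} {p} {q} p⊆q with p zero in p₀ | q zero in q₀
... | false | false = count-mono (p⊆q ∘ suc)
... | false | true  = m≤n⇒m≤1+n (count-mono (p⊆q ∘ suc))
... | true  | true  = s≤s (count-mono (p⊆q ∘ suc))
... | true  | false = case trans (sym (p⊆q zero p₀)) q₀ of λ ()

count-< : ∀ {n} {p q : Fin n → Bool} → p ⊆ᵇ q →
          ∀ j → p j ≡ false → q j ≡ true → count p < count q
count-< {suc n} {p} {q} p⊆q zero pj qj rewrite pj | qj = s≤s (count-mono (p⊆q ∘ suc))
count-< {suc n} {p} {q} p⊆q (suc j) pj qj with p zero in p₀ | q zero in q₀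
... | false | false = count-< (p⊆q ∘ suc) j pj qj
... | false | true  = m≤n⇒m≤1+n (count-< (p⊆q ∘ suc) j pj qj)
... | true  | true  = s≤s (count-< (p⊆q ∘ suc) j pj qj)
... | true  | false = case trans (sym (p⊆q zero p₀)) q₀ of λ ()

count-saturated : ∀ {n} {p q : Fin n → Bool} → p ⊆ᵇ q → count q ≤ count p → q ⊆ᵇ p
count-saturated {p = p} p⊆q q≤p j qj with p j in pj
... | true  = refl
... | false = contradiction q≤p (<⇒≱ (count-< p⊆q j pj qj))

count-cong : ∀ {n} {p q : Fin n → Bool} → (∀ j → p j ≡ q j) → count p ≡ count q
count-cong p≗q = cong sum (tabulate-cong λ j → cong (λ x → if x then 1 else 0) (p≗q j))

sum-tabulate-const : ∀ n y → sum (tabulate {n = n} λ _ → y) ≡ n * y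
sum-tabulate-const zero    y = refl
sum-tabulate-const (suc n) y = cong (y +_) (sum-tabulate-const n y)

hub : ℕ → ∀ {n} → Fin n → Bool
hub b j = does (toℕ j <? b)

sum-tabulate-hub : ∀ {n b} → b ≤ n → ∀ x y →
  sum (tabulate λ (j : Fin n) → if hub b j then x else y) ≡ b * x + (n ∸ b) * y
sum-tabulate-hub {n}     {zero}  _         x y = sum-tabulate-const n y
sum-tabulate-hub {suc n} {suc b} (s≤s b≤n) x y =
  trans (cong (x +_) (sum-tabulate-hub b≤n x y)) (sym (+-assoc x (b * x) _))

count-hub : ∀ {n b} → b ≤ n → count (hub b {n}) ≡ b
count-hub {n} {b} b≤n = begin
  count (hub b {n})               ≡⟨ sum-tabulate-hub {n} b≤n 1 0 ⟩
  b * 1 + (n ∸ b) * 0             ≡⟨ cong₂ _+_ (*-identityʳ b) (*-zeroʳ (n ∸ b)) ⟩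
  b + 0                           ≡⟨ +-identityʳ b ⟩
  b                               ∎
  where open ≡-Reasoning

count-≢ : ∀ {n} (i : Fin n) → count (λ j → not (does (i ≟ j))) ≡ n ∸ 1
count-≢ {suc n}       zero    = trans (sum-tabulate-const n 1) (*-identityʳ n)
count-≢ {suc (suc n)} (suc i) = cong suc (count-≢ i)

sum-map-allFin : ∀ {n} (f : Fin n → ℕ) → sum (map f (allFin n)) ≡ sum (tabulate f)
sum-map-allFin f = cong sum (map-tabulate (λ j → j) f)

degree≡count : ∀ {n} (G : Graph n) i → degree G i ≡ count (adj G i)
degree≡count G i = sum-map-allFin (λ j → if adj G i j then 1 else 0)

adj⊆≢ : ∀ {n} (G : Graph n) i → adj G i ⊆ᵇ (λ j → not (does (i ≟ j)))
adj⊆≢ G i j aᵢⱼ with i ≟ j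
... | yes refl = case trans (sym aᵢⱼ) (irrefl G i) of λ ()
... | no _     = refl

maxDegree⇒adjacent : ∀ {n} (G : Graph n) i → degree G i ≡ n ∸ 1 →
                     ∀ j → i ≢ j → adj G i j ≡ true
maxDegree⇒adjacent {n} G i dᵢ j i≢j =
  count-saturated (adj⊆≢ G i) others≤adj j (cong not (dec-false (i ≟ j) i≢j))
  where
  others≤adj : count (λ j → not (does (i ≟ j))) ≤ count (adj G i)
  others≤adj = ≤-reflexive (begin
    count (λ j → not (does (i ≟ j))) ≡⟨ count-≢ i ⟩
    n ∸ 1                            ≡⟨ dᵢ ⟨
    degree G i                       ≡⟨ degree≡count G i ⟩
    count (adj G i)                  ∎)
    where open ≡-Reasoning

splitSeq : ∀ n → ℕ → Seq n
splitSeq n b i = if hub b i then n ∸ 1 else b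

splitAdj : ∀ {n} → ℕ → Fin n → Fin n → Bool
splitAdj b u v = (hub b u ∨ hub b v) ∧ not (does (u ≟ v))

splitGraph : ∀ n → ℕ → Graph n
splitGraph n b = record { adj = splitAdj b ; sym = splitAdj-sym ; irrefl = splitAdj-irrefl }
  where
  splitAdj-sym : ∀ u v → splitAdj b u v ≡ splitAdj b v u
  splitAdj-sym u v with u ≟ v | v ≟ u
  ... | yes u≡v | no v≢u  = contradiction (sym u≡v) v≢u
  ... | no u≢v  | yes v≡u = contradiction (sym v≡u) u≢v
  ... | yes _   | yes _   = cong (_∧ false) (∨-comm (hub b u) (hub b v))
  ... | no _    | no _    = cong (_∧ true) (∨-comm (hub b u) (hub b v))
  splitAdj-irrefl : ∀ u → splitAdj b u u ≡ false
  splitAdj-irrefl u rewrite dec-true (u ≟ u) refl = ∧-zeroʳ (hub b u ∨ hub b u)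

splitGraph-realizes : ∀ {n b} → b ≤ n → Realizes (splitGraph n b) (splitSeq n b)
splitGraph-realizes {n} {b} b≤n i = trans (degree≡count (splitGraph n b) i) (row (hub b i) refl)
  where
  row : ∀ h → hub b i ≡ h → count (splitAdj b i) ≡ (if h then n ∸ 1 else b)
  row true  hᵢ rewrite hᵢ = count-≢ i
  row false hᵢ rewrite hᵢ = trans (count-cong nonhub-row) (count-hub b≤n)
    where
    nonhub-row : ∀ j → (hub b j ∧ not (does (i ≟ j))) ≡ hub b j
    nonhub-row j with hub b j in hⱼ | i ≟ j
    ... | false | _        = refl
    ... | true  | no _     = refl
    ... | true  | yes refl = case trans (sym hⱼ) hᵢ of λ ()

σ-splitSeq : ∀ {n b} → b ≤ n → σ (splitSeq n b) ≡ b * (n ∸ 1) + (n ∸ b) * b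
σ-splitSeq {n} {b} b≤n = trans (sum-map-allFin (splitSeq n b)) (sum-tabulate-hub b≤n (n ∸ 1) b)

module _ {n b} (b≤n : b ≤ n) {G : Graph n} (G-realizes : Realizes G (splitSeq n b)) where

  hub-adjacent : ∀ i j → hub b i ≡ true → i ≢ j → adj G i j ≡ true
  hub-adjacent i j hᵢ =
    maxDegree⇒adjacent G i (trans (G-realizes i) (cong (λ h → if h then n ∸ 1 else b) hᵢ)) j

  nonhubs-independent : ∀ u v → b ≤ toℕ u → b ≤ toℕ v → adj G u v ≡ false
  nonhubs-independent u v b≤u b≤v with adj G u v in aᵤᵥ
  ... | false = refl
  ... | true  = case trans (sym (adj⊆hub v aᵤᵥ)) (nonhub b≤v) of λ ()
    where
    nonhub : ∀ {w} → b ≤ toℕ w → hub b w ≡ false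
    nonhub {w} b≤w = dec-false (toℕ w <? b) (≤⇒≯ b≤w)
    hub⊆adj : hub b ⊆ᵇ adj G u
    hub⊆adj j hⱼ = trans (Graph.sym G u j)
      (hub-adjacent j u hⱼ λ { refl → case trans (sym hⱼ) (nonhub b≤u) of λ () })
    adj⊆hub : adj G u ⊆ᵇ hub b
    adj⊆hub = count-saturated hub⊆adj (≤-reflexive (begin
      count (adj G u)  ≡⟨ sym (degree≡count G u) ⟩
      degree G u       ≡⟨ G-realizes u ⟩
      splitSeq n b u   ≡⟨ cong (λ h → if h then n ∸ 1 else b) (nonhub b≤u) ⟩
      b                ≡⟨ sym (count-hub b≤n) ⟩
      count (hub b {n}) ∎))
      where open ≡-Reasoning

CliqueCover : ∀ {m} → (Fin m → Fin m → Bool) → ℕ → Set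
CliqueCover {m} H c =
  Σ (Fin m → Fin c) λ class → ∀ u v → u ≢ v → class u ≡ class v → H u v ≡ true

cliqueCover-¬embedding : ∀ {n m b c} {G : Graph n} {H : Fin m → Fin m → Bool} →
  CliqueCover H c → b + c < m → (∀ u v → b ≤ toℕ u → b ≤ toℕ v → adj G u v ≡ false) →
  ¬ ContainsSubgraph G H
cliqueCover-¬embedding {m = m} {b} {c} (class , clique) b+c<m rest-independent (f , f-inj , f-hom)
  = no-collision (pigeonhole b+c<m (join b c ∘ code))
  where
  classify : ∀ u → Dec (toℕ (f u) < b) → Fin b ⊎ Fin c
  classify u (yes fᵤ<b) = inj₁ (fromℕ< fᵤ<b)
  classify u (no _)     = inj₂ (class u)
  code : Fin m → Fin b ⊎ Fin c
  code u = classify u (toℕ (f u) <? b)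
  join-injective : ∀ {x y} → join b c x ≡ join b c y → x ≡ y
  join-injective {x} {y} e =
    trans (sym (splitAt-join b c x)) (trans (cong (splitAt b) e) (splitAt-join b c y))
  collision : ∀ i j → i ≢ j → ∀ dᵢ dⱼ → classify i dᵢ ≡ classify j dⱼ → ⊥
  collision i j i≢j (yes p) (yes q) e =
    i≢j (f-inj (toℕ-injective (fromℕ<-injective _ _ p q (inj₁-injective e))))
  collision i j i≢j (no p) (no q) e =
    case trans (sym (f-hom i j (clique i j i≢j (inj₂-injective e))))
               (rest-independent (f i) (f j) (≮⇒≥ p) (≮⇒≥ q)) of λ ()
  collision i j i≢j (yes _) (no _) ()
  collision i j i≢j (no _) (yes _) ()
  no-collision : (∃₂ λ i j → i F.< j × join b c (code i) ≡ join b c (code j)) → ⊥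
  no-collision (i , j , i<j , e) =
    collision i j (<⇒≢ i<j) (toℕ (f i) <? b) (toℕ (f j) <? b) (join-injective e)

parity₂ : ℕ → Fin 2
parity₂ zero          = zero
parity₂ (suc zero)    = suc zero
parity₂ (suc (suc n)) = parity₂ n

parity₂-suc : ∀ n → parity₂ (suc n) ≢ parity₂ n
parity₂-suc zero          ()
parity₂-suc (suc zero)    ()
parity₂-suc (suc (suc n)) = parity₂-suc n

KmMinusPk-cliqueCover : ∀ m k → CliqueCover (KmMinusPk m k) 2
KmMinusPk-cliqueCover m k = (λ u → parity₂ (toℕ u)) , same-parity-adjacent
  where
  ≡ᵇ-false : ∀ {x y} → x ≢ y → (x ≡ᵇ y) ≡ false
  ≡ᵇ-false {x} {y} = dec-false (x ≟ℕ y)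
  not-successor : ∀ x y → parity₂ x ≡ parity₂ y → suc x ≢ y
  not-successor x _ px≡py refl = parity₂-suc x (sym px≡py)
  same-parity-adjacent : ∀ u v → u ≢ v → parity₂ (toℕ u) ≡ parity₂ (toℕ v) → KmMinusPk m k u v ≡ true
  same-parity-adjacent u v u≢v p = all-false
    (≡ᵇ-false (u≢v ∘ toℕ-injective)) (≡ᵇ-false (not-successor (toℕ u) (toℕ v) p))
    (≡ᵇ-false (not-successor (toℕ v) (toℕ u) (sym p)))
    where
    all-false : ∀ {d₀ d₁ d₂ x y} → d₀ ≡ false → d₁ ≡ false → d₂ ≡ false →
                (not d₀ ∧ not ((d₁ ∧ x) ∨ (d₂ ∧ y))) ≡ true
    all-false refl refl refl = refl

splitSeq-avoids-KmMinusPk : ∀ {n b} k → b ≤ n →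
                            ¬ PotentiallyGraphical (KmMinusPk (3 + b) k) (splitSeq n b)
splitSeq-avoids-KmMinusPk {b = b} k b≤n (G , G-realizes , KmMinusPk⊆G) =
  cliqueCover-¬embedding {b = b} {G = G} (KmMinusPk-cliqueCover (3 + b) k) b+2<3+b
    (nonhubs-independent b≤n {G} G-realizes) KmMinusPk⊆G
  where
  b+2<3+b : b + 2 < 3 + b
  b+2<3+b = subst (_< 3 + b) (+-comm 2 b) (n<1+n (2 + b))

even-<⇒+2≤ : ∀ {m n} → 2 ∣ m → 2 ∣ n → m < n → m + 2 ≤ n
even-<⇒+2≤ (divides p refl) (divides q refl) p2<q2 = begin
  p * 2 + 2 ≡⟨ +-comm (p * 2) 2 ⟩
  suc p * 2 ≤⟨ *-monoˡ-≤ 2 (*-cancelʳ-< 2 p q p2<q2) ⟩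
  q * 2     ∎
  where open ≤-Reasoning

sigmaLowerBound-witness : ∀ {n m} {H : Fin m → Fin m → Bool} {S : Seq n} →
  Graphical S → ¬ PotentiallyGraphical H S → 2 ∣ σ S → SigmaLowerBound H n (σ S + 2)
sigmaLowerBound-witness S-graphical S-avoids 2∣σS l 2∣l l-works =
  even-<⇒+2≤ 2∣σS 2∣l (≰⇒> λ l≤σS → S-avoids (l-works _ S-graphical l≤σS))

2∣n*[1+n] : ∀ n → 2 ∣ n * suc n
2∣n*[1+n] zero    = divides 0 refl
2∣n*[1+n] (suc n) = subst (2 ∣_) (step n) (∣m∣n⇒∣m+n (2∣n*[1+n] n) (n∣m*n (suc n)))
  where
  step : ∀ n → n * suc n + suc n * 2 ≡ suc n * suc (suc n)
  step = solve-∀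

split-degree-sum : ∀ b r → b * suc b + (b * (2 + b + r) + (3 + r) * b) ≡ 2 * b * (3 + b + r)
split-degree-sum = solve-∀

2*[3+b]≡6+2*b : ∀ b → 2 * (3 + b) ≡ 6 + 2 * b
2*[3+b]≡6+2*b = solve-∀

module _ (b r : ℕ) where

  private
    n = 3 + b + r
    s = b * (2 + b + r) + (3 + r) * b

  b≤3+b+r : b ≤ n
  b≤3+b+r = ≤-trans (m≤n+m b 3) (m≤m+n (3 + b) r)

  σ-split : σ (splitSeq n b) ≡ s
  σ-split = trans (σ-splitSeq b≤3+b+r) (cong (λ x → b * (2 + b + r) + x * b) n∸b)
    where
    n∸b : n ∸ b ≡ 3 + r
    n∸b = trans (cong (λ x → 3 + x ∸ b) (+-comm b r)) (m+n∸n≡m (3 + r) b)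

  2∣split : 2 ∣ s
  2∣split = ∣m+n∣m⇒∣n (subst (2 ∣_) (sym (split-degree-sum b r)) (∣-trans (m∣m*n b) (m∣m*n n)))
                      (2∣n*[1+n] b)

  split-bound : ((2 * (3 + b) ∸ 6) * n + 2) ∸ ((3 + b ∸ 3) * (3 + b ∸ 2)) ≡ s + 2
  split-bound = begin
    ((2 * (3 + b) ∸ 6) * n + 2) ∸ (b * suc b) ≡⟨ cong (λ x → (x * n + 2) ∸ (b * suc b)) 2*[3+b]∸6 ⟩
    (2 * b * n + 2) ∸ (b * suc b)             ≡⟨ cong (λ x → x + 2 ∸ (b * suc b)) (split-degree-sum b r) ⟨
    (b * suc b + s) + 2 ∸ (b * suc b)         ≡⟨ cong (_∸ (b * suc b)) (+-assoc (b * suc b) s 2) ⟩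
    b * suc b + (s + 2) ∸ (b * suc b)         ≡⟨ m+n∸m≡n (b * suc b) (s + 2) ⟩
    s + 2                                     ∎
    where
    open ≡-Reasoning
    2*[3+b]∸6 : 2 * (3 + b) ∸ 6 ≡ 2 * b
    2*[3+b]∸6 = trans (cong (_∸ 6) (2*[3+b]≡6+2*b b)) (m+n∸m≡n 6 (2 * b))

theorem1 : (n m k : ℕ) → m ≤ n → k + 1 ≤ m → 4 ≤ k + 1 →
    SigmaLowerBound (KmMinusPk m k) n (((2 * m ∸ 6) * n + 2) ∸ ((m ∸ 3) * (m ∸ 2)))
theorem1 n m k m≤n k+1≤m 4≤k+1 with m≤n⇒∃[o]m+o≡n (≤-trans (n≤1+n 3) (≤-trans 4≤k+1 k+1≤m))
... | b , refl with m≤n⇒∃[o]m+o≡n m≤n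
... | r , refl = subst (SigmaLowerBound (KmMinusPk (3 + b) k) (3 + b + r))
                       (trans (cong (_+ 2) (σ-split b r)) (sym (split-bound b r)))
                       (sigmaLowerBound-witness (splitGraph _ b , splitGraph-realizes (b≤3+b+r b r))
                                                (splitSeq-avoids-KmMinusPk k (b≤3+b+r b r))
                                                (subst (2 ∣_) (sym (σ-split b r)) (2∣split b r)))
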